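{- Let $\mathbb{M}\in\{\mathsf K,\mathsf D,\mathsf T,\mathsf{K4},\mathsf{S4}\}$. Let $\Pi$ be a $2_{\mathbb M}$-proof with conclusion $\Gamma\vdash\Delta$, let $\delta\circ z$ be a position ($\delta$ a position, $z$ a token), and let $b$ be a token not occurring in $\Pi$ nor in $\delta\circ z$. Then there is a $2_{\mathbb M}$-proof $\Pi[\delta\circ z/\delta\circ b]$ with conclusion $\Gamma[\delta\circ z/\delta\circ b]\vdash\Delta[\delta\circ z/\delta\circ b]$.
   Context: Prefix replacement: for positions $s,u,v$, $s[u/v]=v\circ t$ if $s=u\circ t$ for some $t$, and $s[u/v]=s$ otherwise; for a sequence $\Gamma$ of p-formulas, $\Gamma[u/v]$ applies this to the position of each p-formula. Modal formulas over proposition symbols with $\neg,\wedge,\vee,\to,\Box,\Diamond$. Fix a countably infinite set of tokens; a position is a finite (possibly empty) sequence of tokens, $\circ$ concatenation, $\alpha\circ x=\alpha\circ\langle x\rangle$, $\beta\preceq\alpha$ means $\beta$ is a prefix of $\alpha$. A p-formula is $A^\alpha$; a 2-sequent is $\Gamma\vdash\Delta$ with $\Gamma,\Delta$ finite sequences of p-formulas; $I(\Gamma)=\{\beta:\exists A^\alpha\in\Gamma,\ \beta\preceq\alpha\}$. Calculus $2_{\mathsf{S4}}$: Axiom $A^\alpha\vdash A^\alpha$; Cut: from $\Gamma_1\vdash A^\alpha,\Delta_1$ and $\Gamma_2,A^\alpha\vdash\Delta_2$ infer $\Gamma_1,\Gamma_2\vdash\Delta_1,\Delta_2$; weakening, contraction,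 exchange; classical propositional sequent rules for $\neg,\wedge,\vee,\to$ with all active p-formulas at the same position; modal rules: ($\Box\vdash$) from $\Gamma,A^{\alpha\circ\beta}\vdash\Delta$ infer $\Gamma,(\Box A)^\alpha\vdash\Delta$; ($\vdash\Box$) from $\Gamma\vdash A^{\alpha\circ x},\Delta$ infer $\Gamma\vdash(\Box A)^\alpha,\Delta$; ($\Diamond\vdash$) from $\Gamma,A^{\alpha\circ x}\vdash\Delta$ infer $\Gamma,(\Diamond A)^\alpha\vdash\Delta$; ($\vdash\Diamond$) from $\Gamma\vdash A^{\alpha\circ\beta},\Delta$ infer $\Gamma\vdash(\Diamond A)^\alpha,\Delta$; $\beta$ a position, $x$ a token, and in $\vdash\Box,\Diamond\vdash$, $\alpha\circ x\notin I(\Gamma,\Delta)$. $2_{\mathsf T},2_{\mathsf D},2_{\mathsf{K4}},2_{\mathsf K}$ add constraints on $\Box\vdash,\vdash\Diamond$: $2_{\mathsf T}$: $\beta$ empty or a single token; $2_{\mathsf D}$: $\beta$ a single token; $2_{\mathsf{K4}}$: $\beta$ nonempty and $\Gamma$ or $\Delta$ contains some $B^{\alpha\circ\beta\circ\eta}$; $2_{\mathsf K}$: $\beta$ a single token and $\Gamma$ or $\Delta$ contains some $B^{\alpha\circ\beta\circ\eta}$. In $2_{\mathsf K},2_{\mathsf{K4}}$ Cut requires $\alpha\in I(\Gamma_1,\Delta_1)$ or $\alpha\in I(\Gamma_2,\Delta_2)$. -}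

module Defs where

open import Data.Nat using (ℕ; _≤_)
open import Data.Nat.Properties using (_≟_)
open import Data.List using (List; []; _∷_; _++_; [_]; _∷ʳ_; length; concatMap; map)
open import Data.List.Relation.Unary.Any using (Any)
open import Data.Maybe using (Maybe; just; nothing)
open import Data.Product using (Σ; ∃; _×_; _,_)
open import Data.Sum using (_⊎_)
open import Data.Unit using (⊤)
open import Relation.Nullary using (¬_; yes; no)
open import Relation.Binary.PropositionalEquality using (_≡_)

Token : Set
Token = ℕ

-- Positions: finite sequences of tokens; ∘ is list concatenation.
Pos : Set
Pos = List Token

_⪯_ : Pos → Pos → Set
β ⪯ α = ∃ λ t → α ≡ β ++ t

data Fml : Set where
  var  : ℕ → Fml
  ¬'_  : Fml → Fml
  _∧'_ : Fml → Fml → Fml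
  _∨'_ : Fml → Fml → Fml
  _⇒'_ : Fml → Fml → Fml
  □_   : Fml → Fml
  ◇_   : Fml → Fml

record PFml : Set where
  constructor _^_
  field
    fml : Fml
    pos : Pos
open PFml public

_∈I_ : Pos → List PFml → Set
β ∈I Γ = Any (λ p → β ⪯ pos p) Γ

data Logic : Set where
  K D T K4 S4 : Logic

BoxOK : Logic → Pos → Pos → List PFml → List PFml → Set
BoxOK S4 α β Γ Δ = ⊤
BoxOK T  α β Γ Δ = length β ≤ 1
BoxOK D  α β Γ Δ = ∃ λ (x : Token) → β ≡ [ x ]
BoxOK K4 α β Γ Δ = (¬ (β ≡ [])) × ((α ++ β) ∈I (Γ ++ Δ))
BoxOK K  α β Γ Δ = (∃ λ (x : Token) → β ≡ [ x ]) × ((α ++ β) ∈I (Γ ++ Δ))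

CutOK : Logic → Pos → List PFml → List PFml → List PFml → List PFml → Set
CutOK K  α Γ₁ Δ₁ Γ₂ Δ₂ = (α ∈I (Γ₁ ++ Δ₁)) ⊎ (α ∈I (Γ₂ ++ Δ₂))
CutOK K4 α Γ₁ Δ₁ Γ₂ Δ₂ = (α ∈I (Γ₁ ++ Δ₁)) ⊎ (α ∈I (Γ₂ ++ Δ₂))
CutOK D  α Γ₁ Δ₁ Γ₂ Δ₂ = ⊤
CutOK T  α Γ₁ Δ₁ Γ₂ Δ₂ = ⊤
CutOK S4 α Γ₁ Δ₁ Γ₂ Δ₂ = ⊤

-- The calculus 2_M. Antecedent "Γ, A" is Γ ∷ʳ A; succedent "A, Δ" is A ∷ Δ.
data Proof (M : Logic) : List PFml → List PFml → Set where
  ax   : ∀ A α → Proof M [ A ^ α ] [ A ^ α ]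
  cut  : ∀ {Γ₁ Δ₁ Γ₂ Δ₂} A α → CutOK M α Γ₁ Δ₁ Γ₂ Δ₂ →
         Proof M Γ₁ ((A ^ α) ∷ Δ₁) → Proof M (Γ₂ ∷ʳ (A ^ α)) Δ₂ →
         Proof M (Γ₁ ++ Γ₂) (Δ₁ ++ Δ₂)
  wL   : ∀ {Γ Δ} P → Proof M Γ Δ → Proof M (Γ ∷ʳ P) Δ
  wR   : ∀ {Γ Δ} P → Proof M Γ Δ → Proof M Γ (P ∷ Δ)
  cL   : ∀ {Γ Δ} P → Proof M ((Γ ∷ʳ P) ∷ʳ P) Δ → Proof M (Γ ∷ʳ P) Δ
  cR   : ∀ {Γ Δ} P → Proof M Γ (P ∷ P ∷ Δ) → Proof M Γ (P ∷ Δ)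
  eL   : ∀ {Γ₁ Γ₂ Δ} P Q → Proof M (Γ₁ ++ P ∷ Q ∷ Γ₂) Δ → Proof M (Γ₁ ++ Q ∷ P ∷ Γ₂) Δ
  eR   : ∀ {Γ Δ₁ Δ₂} P Q → Proof M Γ (Δ₁ ++ P ∷ Q ∷ Δ₂) → Proof M Γ (Δ₁ ++ Q ∷ P ∷ Δ₂)
  ¬L   : ∀ {Γ Δ} A α → Proof M Γ ((A ^ α) ∷ Δ) → Proof M (Γ ∷ʳ ((¬' A) ^ α)) Δ
  ¬R   : ∀ {Γ Δ} A α → Proof M (Γ ∷ʳ (A ^ α)) Δ → Proof M Γ (((¬' A) ^ α) ∷ Δ)
  ∧L₁  : ∀ {Γ Δ} A B α → Proof M (Γ ∷ʳ (A ^ α)) Δ → Proof M (Γ ∷ʳ ((A ∧' B) ^ α)) Δ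
  ∧L₂  : ∀ {Γ Δ} A B α → Proof M (Γ ∷ʳ (B ^ α)) Δ → Proof M (Γ ∷ʳ ((A ∧' B) ^ α)) Δ
  ∧R   : ∀ {Γ Δ} A B α → Proof M Γ ((A ^ α) ∷ Δ) → Proof M Γ ((B ^ α) ∷ Δ) →
         Proof M Γ (((A ∧' B) ^ α) ∷ Δ)
  ∨L   : ∀ {Γ Δ} A B α → Proof M (Γ ∷ʳ (A ^ α)) Δ → Proof M (Γ ∷ʳ (B ^ α)) Δ →
         Proof M (Γ ∷ʳ ((A ∨' B) ^ α)) Δ
  ∨R₁  : ∀ {Γ Δ} A B α → Proof M Γ ((A ^ α) ∷ Δ) → Proof M Γ (((A ∨' B) ^ α) ∷ Δ)
  ∨R₂  : ∀ {Γ Δ} A B α → Proof M Γ ((B ^ α) ∷ Δ) → Proof M Γ (((A ∨' B) ^ α) ∷ Δ)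
  ⇒L   : ∀ {Γ₁ Δ₁ Γ₂ Δ₂} A B α → Proof M Γ₁ ((A ^ α) ∷ Δ₁) → Proof M (Γ₂ ∷ʳ (B ^ α)) Δ₂ →
         Proof M ((Γ₁ ++ Γ₂) ∷ʳ ((A ⇒' B) ^ α)) (Δ₁ ++ Δ₂)
  ⇒R   : ∀ {Γ Δ} A B α → Proof M (Γ ∷ʳ (A ^ α)) ((B ^ α) ∷ Δ) →
         Proof M Γ (((A ⇒' B) ^ α) ∷ Δ)
  □L   : ∀ {Γ Δ} A α β → BoxOK M α β Γ Δ →
         Proof M (Γ ∷ʳ (A ^ (α ++ β))) Δ → Proof M (Γ ∷ʳ ((□ A) ^ α)) Δ
  □R   : ∀ {Γ Δ} A α (x : Token) → ¬ ((α ∷ʳ x) ∈I (Γ ++ Δ)) →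
         Proof M Γ ((A ^ (α ∷ʳ x)) ∷ Δ) → Proof M Γ (((□ A) ^ α) ∷ Δ)
  ◇L   : ∀ {Γ Δ} A α (x : Token) → ¬ ((α ∷ʳ x) ∈I (Γ ++ Δ)) →
         Proof M (Γ ∷ʳ (A ^ (α ∷ʳ x))) Δ → Proof M (Γ ∷ʳ ((◇ A) ^ α)) Δ
  ◇R   : ∀ {Γ Δ} A α β → BoxOK M α β Γ Δ →
         Proof M Γ ((A ^ (α ++ β)) ∷ Δ) → Proof M Γ (((◇ A) ^ α) ∷ Δ)

tokensL : List PFml → List Token
tokensL Γ = concatMap pos Γ

tokens : ∀ {M Γ Δ} → Proof M Γ Δ → List Token
tokens {Γ = Γ} {Δ} π = tokensL Γ ++ tokensL Δ ++ sub π
  where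
  sub : ∀ {M Γ Δ} → Proof M Γ Δ → List Token
  sub (ax A α) = []
  sub (cut A α _ p q) = tokens p ++ tokens q
  sub (wL P p) = tokens p
  sub (wR P p) = tokens p
  sub (cL P p) = tokens p
  sub (cR P p) = tokens p
  sub (eL P Q p) = tokens p
  sub (eR P Q p) = tokens p
  sub (¬L A α p) = tokens p
  sub (¬R A α p) = tokens p
  sub (∧L₁ A B α p) = tokens p
  sub (∧L₂ A B α p) = tokens p
  sub (∧R A B α p q) = tokens p ++ tokens q
  sub (∨L A B α p q) = tokens p ++ tokens q
  sub (∨R₁ A B α p) = tokens p
  sub (∨R₂ A B α p) = tokens p
  sub (⇒L A B α p q) = tokens p ++ tokens q
  sub (⇒R A B α p) = tokens p
  sub (□L A α β _ p) = tokens p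
  sub (□R A α x _ p) = tokens p
  sub (◇L A α x _ p) = tokens p
  sub (◇R A α β _ p) = tokens p

stripPrefix : Pos → Pos → Maybe Pos
stripPrefix [] s = just s
stripPrefix (x ∷ u) [] = nothing
stripPrefix (x ∷ u) (y ∷ s) with x ≟ y
... | yes _ = stripPrefix u s
... | no _  = nothing

_[_/_]ₚ : Pos → Pos → Pos → Pos
s [ u / v ]ₚ with stripPrefix u s
... | just t  = v ++ t
... | nothing = s

_[_/_] : List PFml → Pos → Pos → List PFml
Γ [ u / v ] = map (λ p → fml p ^ (pos p [ u / v ]ₚ)) Γ

module Submission where

-- Fix δ, z and a token b that is fresh for the proof Π, and let
-- f s = s[δ∘z/δ∘b].  The positions δ∘z and δ∘b are siblings: they differ
-- only in their last token.  This makes f length preserving and monotone for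
-- the prefix order ⪯, so f sends every extension α∘β to an extension
-- f(α)∘β' with |β'| = |β|.  On positions not containing b, the reverse
-- replacement [δ∘b/δ∘z] undoes f, so there f also reflects ⪯.
-- Lifted to sequences, f maps I(Γ) into I(Γ[δ∘z/δ∘b]) and, for b-free Γ,
-- reflects membership.  Hence the side conditions of every rule of 2_M
-- survive the renaming: those of (□⊢), (⊢◇) and Cut by monotonicity and
-- length preservation, the eigen-token conditions of (⊢□) and (◇⊢) by
-- reflection.  The theorem follows by renaming all p-formulas of Π, by
-- structural induction on Π.

open import Defs
open import Data.Empty using (⊥-elim)
open import Data.List using (List; []; _∷_; _++_; [_]; _∷ʳ_; length)
open import Data.List.Membership.Propositional using (_∉_)
open import Data.List.Membership.Propositional.Properties using (∈-++⁺ˡ; ∈-++⁺ʳ; ∈-++⁻)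
open import Data.List.Properties using (∷-injective; ++-assoc; ++-cancelˡ; ∷ʳ-++; length-++; map-++; concatMap-++)
open import Data.List.Relation.Unary.Any using (here; there)
import Data.List.Relation.Unary.Any as Any
open import Data.List.Relation.Unary.Any.Properties using (map⁺)
open import Data.Maybe using (just; nothing)
open import Data.Nat using (suc; _≤_; _+_)
open import Data.Nat.Properties using (_≟_; +-cancelˡ-≡)
open import Data.Product using (∃; _×_; _,_; proj₁; proj₂)
open import Data.Sum using (inj₁; inj₂)
import Data.Sum as Sum
open import Data.Unit using (tt)
open import Relation.Nullary using (¬_; yes; no)
open import Relation.Binary.PropositionalEquality
  using (_≡_; refl; sym; trans; cong; subst; subst₂; module ≡-Reasoning)

⪯-++ : ∀ α β → α ⪯ (α ++ β)
⪯-++ α β = β , refl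

⪯-trans : ∀ {α β γ} → α ⪯ β → β ⪯ γ → α ⪯ γ
⪯-trans {α} (r , refl) (s , refl) = r ++ s , ++-assoc α r s

stripPrefix-++ : ∀ u t → stripPrefix u (u ++ t) ≡ just t
stripPrefix-++ []      t = refl
stripPrefix-++ (x ∷ u) t with x ≟ x
... | yes _  = stripPrefix-++ u t
... | no x≢x = ⊥-elim (x≢x refl)

stripPrefix-just : ∀ u s {t} → stripPrefix u s ≡ just t → s ≡ u ++ t
stripPrefix-just []      s       refl = refl
stripPrefix-just (x ∷ u) []      ()
stripPrefix-just (x ∷ u) (y ∷ s) eq with x ≟ y
... | yes refl = cong (x ∷_) (stripPrefix-just u s eq)
stripPrefix-just (x ∷ u) (y ∷ s) () | no _

replace-just : ∀ u v s {t} → stripPrefix u s ≡ just t → s [ u / v ]ₚ ≡ v ++ t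
replace-just u v s eq rewrite eq = refl

replace-nothing : ∀ u v s → stripPrefix u s ≡ nothing → s [ u / v ]ₚ ≡ s
replace-nothing u v s eq rewrite eq = refl

replace-prefixed : ∀ u v t → (u ++ t) [ u / v ]ₚ ≡ v ++ t
replace-prefixed u v t = replace-just u v (u ++ t) (stripPrefix-++ u t)

data Replacement (u v s : Pos) : Set where
  replaced : ∀ t → s ≡ u ++ t → s [ u / v ]ₚ ≡ v ++ t → Replacement u v s
  kept     : ¬ (u ⪯ s) → s [ u / v ]ₚ ≡ s → Replacement u v s

replacement : ∀ u v s → Replacement u v s
replacement u v s with stripPrefix u s in eq
... | just t  = replaced t (stripPrefix-just u s eq) (replace-just u v s eq)
... | nothing = kept u⋠s (replace-nothing u v s eq)
  where
  u⋠s : ¬ (u ⪯ s)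
  u⋠s (t , refl) with () ← trans (sym eq) (stripPrefix-++ u t)

sibling-prefix : ∀ δ c p r t → p ++ r ≡ (δ ∷ʳ c) ++ t → ¬ ((δ ∷ʳ c) ⪯ p) → p ⪯ δ
sibling-prefix δ       c []      r t e c⋠p = δ , refl
sibling-prefix []      c (y ∷ p) r t refl c⋠p = ⊥-elim (c⋠p (p , refl))
sibling-prefix (x ∷ δ) c (y ∷ p) r t e c⋠p with ∷-injective e
... | refl , e′ with sibling-prefix δ c p r t e′ (λ (w , e″) → c⋠p (w , cong (x ∷_) e″))
... | w , refl = w , refl

sibling-length : ∀ δ (c d : Token) (t : Pos) → length ((δ ∷ʳ c) ++ t) ≡ length ((δ ∷ʳ d) ++ t)
sibling-length []      c d t = refl
sibling-length (x ∷ δ) c d t = cong suc (sibling-length δ c d t)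

module SiblingReplacement (δ : Pos) (c d : Token) where

  f : Pos → Pos
  f s = s [ δ ∷ʳ c / δ ∷ʳ d ]ₚ

  f-length : ∀ s → length (f s) ≡ length s
  f-length s with replacement (δ ∷ʳ c) (δ ∷ʳ d) s
  ... | replaced t refl fs = trans (cong length fs) (sym (sibling-length δ c d t))
  ... | kept _ fs          = cong length fs

  -- If p ⪯ q are both renamed or both kept this is immediate; if only q is
  -- renamed, p branches off before δ∘c (sibling-prefix) and so stays below
  -- δ ⪯ f q; p renamed but q kept is impossible.
  f-mono : ∀ {p q} → p ⪯ q → f p ⪯ f q
  f-mono {p} (r , refl) with replacement (δ ∷ʳ c) (δ ∷ʳ d) p
                           | replacement (δ ∷ʳ c) (δ ∷ʳ d) (p ++ r)
  ... | replaced t refl fp | replaced t′ e fq = subst₂ _⪯_ (sym fp) (sym fq) (r , v++t′≡)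
    where
    t′≡ : t′ ≡ t ++ r
    t′≡ = ++-cancelˡ (δ ∷ʳ c) t′ (t ++ r) (trans (sym e) (++-assoc (δ ∷ʳ c) t r))
    v++t′≡ : (δ ∷ʳ d) ++ t′ ≡ ((δ ∷ʳ d) ++ t) ++ r
    v++t′≡ = trans (cong ((δ ∷ʳ d) ++_) t′≡) (sym (++-assoc (δ ∷ʳ d) t r))
  ... | replaced t refl _  | kept c⋠q _ = ⊥-elim (c⋠q (t ++ r , ++-assoc (δ ∷ʳ c) t r))
  ... | kept c⋠p fp | replaced t′ e fq =
    subst₂ _⪯_ (sym fp) (sym fq)
      (⪯-trans (sibling-prefix δ c p r t′ e c⋠p) (d ∷ t′ , ∷ʳ-++ δ d t′))
  ... | kept _ fp | kept _ fq = subst₂ _⪯_ (sym fp) (sym fq) (r , refl)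

  -- Since f preserves lengths, the extension f α ⪯ f (α ∘ β) has length |β|.
  f-extend : ∀ α β → ∃ λ β′ → f (α ++ β) ≡ f α ++ β′ × length β′ ≡ length β
  f-extend α β with f-mono (⪯-++ α β)
  ... | β′ , e = β′ , e , +-cancelˡ-≡ (length α) (length β′) (length β) lengths
    where
    open ≡-Reasoning
    lengths : length α + length β′ ≡ length α + length β
    lengths = begin
      length α + length β′     ≡⟨ cong (_+ length β′) (sym (f-length α)) ⟩
      length (f α) + length β′ ≡⟨ sym (length-++ (f α)) ⟩
      length (f α ++ β′)       ≡⟨ cong length (sym e) ⟩
      length (f (α ++ β))      ≡⟨ f-length (α ++ β) ⟩
      length (α ++ β)          ≡⟨ length-++ α ⟩
      length α + length β      ∎

  f-extend₁ : ∀ α x → ∃ λ x′ → f (α ∷ʳ x) ≡ f α ∷ʳ x′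
  f-extend₁ α x with f-extend α [ x ]
  ... | x′ ∷ [] , e , _ = x′ , e

module _ {x : Token} where

  ∉-++ˡ : ∀ xs {ys} → x ∉ xs ++ ys → x ∉ xs
  ∉-++ˡ xs x∉ m = x∉ (∈-++⁺ˡ m)

  ∉-++ʳ : ∀ xs {ys} → x ∉ xs ++ ys → x ∉ ys
  ∉-++ʳ xs x∉ m = x∉ (∈-++⁺ʳ xs m)

  ∉-++ : ∀ xs {ys} → x ∉ xs → x ∉ ys → x ∉ xs ++ ys
  ∉-++ xs x∉xs x∉ys m with ∈-++⁻ xs m
  ... | inj₁ m₁ = x∉xs m₁
  ... | inj₂ m₂ = x∉ys m₂

  fresh-conclusion : ∀ {M Γ Δ} (π : Proof M Γ Δ) → x ∉ tokens π → x ∉ tokensL Γ × x ∉ tokensL Δ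
  fresh-conclusion {Γ = Γ} {Δ} π x∉ = ∉-++ˡ (tokensL Γ) x∉ , ∉-++ˡ (tokensL Δ) (∉-++ʳ (tokensL Γ) x∉)

  -- … and for the immediate subproofs; π only fixes the end sequent Γ ⊢ Δ, so
  -- that zs is determined by unfolding tokens π.
  fresh-below : ∀ {M Γ Δ zs} → Proof M Γ Δ → x ∉ tokensL Γ ++ tokensL Δ ++ zs → x ∉ zs
  fresh-below {Γ = Γ} {Δ} _ x∉ = ∉-++ʳ (tokensL Δ) (∉-++ʳ (tokensL Γ) x∉)

  fresh-∷ʳ : ∀ Γ P → x ∉ tokensL (Γ ∷ʳ P) → x ∉ tokensL Γ × x ∉ pos P
  fresh-∷ʳ Γ P x∉ = ∉-++ˡ (tokensL Γ) x∉′ , λ m → ∉-++ʳ (tokensL Γ) x∉′ (∈-++⁺ˡ m)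
    where
    x∉′ : x ∉ tokensL Γ ++ tokensL [ P ]
    x∉′ = subst (x ∉_) (concatMap-++ pos Γ [ P ]) x∉

module _ {A : Set} where

  singleton-length : ∀ {β β′ : List A} → length β′ ≡ length β → ∃ (λ x → β ≡ [ x ]) → ∃ λ x′ → β′ ≡ [ x′ ]
  singleton-length {β′ = x′ ∷ []} _ (_ , refl) = x′ , refl

  nonempty-length : ∀ {β β′ : List A} → length β′ ≡ length β → ¬ β ≡ [] → ¬ β′ ≡ []
  nonempty-length {[]}    _  β≢[] _  = β≢[] refl
  nonempty-length {_ ∷ _} () _    refl

castL : ∀ {M Γ Γ′ Δ} → Γ ≡ Γ′ → Proof M Γ Δ → Proof M Γ′ Δ
castL refl π = π

castR : ∀ {M Γ Δ Δ′} → Δ ≡ Δ′ → Proof M Γ Δ → Proof M Γ Δ′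
castR refl π = π

module Renaming (δ : Pos) (z b : Token) where

  open SiblingReplacement δ z b
  module Back = SiblingReplacement δ b z

  f-inverse : ∀ s → b ∉ s → Back.f (f s) ≡ s
  f-inverse s b∉s with replacement (δ ∷ʳ z) (δ ∷ʳ b) s
  ... | replaced t refl fs = trans (cong Back.f fs) (replace-prefixed (δ ∷ʳ b) (δ ∷ʳ z) t)
  ... | kept _ fs with replacement (δ ∷ʳ b) (δ ∷ʳ z) s
  ...   | replaced t refl _ = ⊥-elim (b∉s (∈-++⁺ˡ (∈-++⁺ʳ δ (here refl))))
  ...   | kept _ gs = trans (cong Back.f fs) gs

  f-reflect : ∀ {p q} → b ∉ p → b ∉ q → f p ⪯ f q → p ⪯ q
  f-reflect {p} {q} b∉p b∉q fp⪯fq =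
    subst₂ _⪯_ (f-inverse p b∉p) (f-inverse q b∉q) (Back.f-mono fp⪯fq)

  g : PFml → PFml
  g P = fml P ^ f (pos P)

  S : List PFml → List PFml
  S Γ = Γ [ δ ∷ʳ z / δ ∷ʳ b ]

  S-++ : ∀ Γ Δ → S (Γ ++ Δ) ≡ S Γ ++ S Δ
  S-++ = map-++ g

  S-∷ʳ : ∀ Γ P → S (Γ ∷ʳ P) ≡ S Γ ∷ʳ g P
  S-∷ʳ Γ P = S-++ Γ [ P ]

  I-preserve : ∀ {β} Γ Δ → β ∈I (Γ ++ Δ) → f β ∈I (S Γ ++ S Δ)
  I-preserve Γ Δ i = subst (_ ∈I_) (S-++ Γ Δ) (map⁺ (Any.map f-mono i))

  I-reflect : ∀ {β} Γ → b ∉ tokensL Γ → b ∉ β → f β ∈I S Γ → β ∈I Γ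
  I-reflect (P ∷ Γ) b∉ b∉β (here i)  = here (f-reflect b∉β (∉-++ˡ (pos P) b∉) i)
  I-reflect (P ∷ Γ) b∉ b∉β (there i) = there (I-reflect Γ (∉-++ʳ (pos P) b∉) b∉β i)

  box-ok : ∀ M {α β β′} Γ Δ → f (α ++ β) ≡ f α ++ β′ → length β′ ≡ length β →
           BoxOK M α β Γ Δ → BoxOK M (f α) β′ (S Γ) (S Δ)
  box-ok K  Γ Δ e l (β-single , i)   = singleton-length l β-single , subst (_∈I _) e (I-preserve Γ Δ i)
  box-ok D  Γ Δ e l β-single         = singleton-length l β-single
  box-ok T  Γ Δ e l |β|≤1            = subst (_≤ 1) (sym l) |β|≤1
  box-ok K4 Γ Δ e l (β-nonempty , i) = nonempty-length l β-nonempty , subst (_∈I _) e (I-preserve Γ Δ i)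
  box-ok S4 Γ Δ e l _                = tt

  cut-ok : ∀ M {α} Γ₁ Δ₁ Γ₂ Δ₂ → CutOK M α Γ₁ Δ₁ Γ₂ Δ₂ → CutOK M (f α) (S Γ₁) (S Δ₁) (S Γ₂) (S Δ₂)
  cut-ok K  Γ₁ Δ₁ Γ₂ Δ₂ = Sum.map (I-preserve Γ₁ Δ₁) (I-preserve Γ₂ Δ₂)
  cut-ok K4 Γ₁ Δ₁ Γ₂ Δ₂ = Sum.map (I-preserve Γ₁ Δ₁) (I-preserve Γ₂ Δ₂)
  cut-ok D  Γ₁ Δ₁ Γ₂ Δ₂ _ = tt
  cut-ok T  Γ₁ Δ₁ Γ₂ Δ₂ _ = tt
  cut-ok S4 Γ₁ Δ₁ Γ₂ Δ₂ _ = tt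

  eigen-ok : ∀ {α x x′} Γ Δ → b ∉ tokensL Γ → b ∉ tokensL Δ → b ∉ α ∷ʳ x →
             f (α ∷ʳ x) ≡ f α ∷ʳ x′ →
             ¬ ((α ∷ʳ x) ∈I (Γ ++ Δ)) → ¬ ((f α ∷ʳ x′) ∈I (S Γ ++ S Δ))
  eigen-ok Γ Δ b∉Γ b∉Δ b∉αx e αx∉I fαx′∈I =
    αx∉I (I-reflect (Γ ++ Δ) b∉ΓΔ b∉αx (subst₂ _∈I_ (sym e) (sym (S-++ Γ Δ)) fαx′∈I))
    where
    b∉ΓΔ : b ∉ tokensL (Γ ++ Δ)
    b∉ΓΔ = subst (b ∉_) (sym (concatMap-++ pos Γ Δ)) (∉-++ (tokensL Γ) b∉Γ b∉Δ)

  rename : ∀ {M Γ Δ} (π : Proof M Γ Δ) → b ∉ tokens π → Proof M (S Γ) (S Δ)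
  rename (ax A α) _ = ax A (f α)
  rename {M} π@(cut {Γ₁} {Δ₁} {Γ₂} {Δ₂} A α ok p q) h =
    castL (sym (S-++ Γ₁ Γ₂)) (castR (sym (S-++ Δ₁ Δ₂))
      (cut A (f α) (cut-ok M Γ₁ Δ₁ Γ₂ Δ₂ ok)
        (rename p (∉-++ˡ (tokens p) h′)) (castL (S-∷ʳ Γ₂ (A ^ α)) (rename q (∉-++ʳ (tokens p) h′)))))
    where
    h′ : b ∉ tokens p ++ tokens q
    h′ = fresh-below π h
  rename π@(wL {Γ} P p) h = castL (sym (S-∷ʳ Γ P)) (wL (g P) (rename p (fresh-below π h)))
  rename π@(wR P p) h = wR (g P) (rename p (fresh-below π h))
  rename π@(cL {Γ} P p) h =
    castL (sym (S-∷ʳ Γ P))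
      (cL (g P) (castL (trans (S-∷ʳ (Γ ∷ʳ P) P) (cong (_∷ʳ g P) (S-∷ʳ Γ P))) (rename p (fresh-below π h))))
  rename π@(cR P p) h = cR (g P) (rename p (fresh-below π h))
  rename π@(eL {Γ₁} {Γ₂} P Q p) h =
    castL (sym (S-++ Γ₁ (Q ∷ P ∷ Γ₂)))
      (eL (g P) (g Q) (castL (S-++ Γ₁ (P ∷ Q ∷ Γ₂)) (rename p (fresh-below π h))))
  rename π@(eR {Δ₁ = Δ₁} {Δ₂} P Q p) h =
    castR (sym (S-++ Δ₁ (Q ∷ P ∷ Δ₂)))
      (eR (g P) (g Q) (castR (S-++ Δ₁ (P ∷ Q ∷ Δ₂)) (rename p (fresh-below π h))))
  rename π@(¬L {Γ} A α p) h = castL (sym (S-∷ʳ Γ _)) (¬L A (f α) (rename p (fresh-below π h)))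
  rename π@(¬R {Γ} A α p) h = ¬R A (f α) (castL (S-∷ʳ Γ _) (rename p (fresh-below π h)))
  rename π@(∧L₁ {Γ} A B α p) h =
    castL (sym (S-∷ʳ Γ _)) (∧L₁ A B (f α) (castL (S-∷ʳ Γ _) (rename p (fresh-below π h))))
  rename π@(∧L₂ {Γ} A B α p) h =
    castL (sym (S-∷ʳ Γ _)) (∧L₂ A B (f α) (castL (S-∷ʳ Γ _) (rename p (fresh-below π h))))
  rename π@(∧R A B α p q) h =
    ∧R A B (f α) (rename p (∉-++ˡ (tokens p) h′)) (rename q (∉-++ʳ (tokens p) h′))
    where
    h′ : b ∉ tokens p ++ tokens q
    h′ = fresh-below π h
  rename π@(∨L {Γ} A B α p q) h =
    castL (sym (S-∷ʳ Γ _))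
      (∨L A B (f α) (castL (S-∷ʳ Γ _) (rename p (∉-++ˡ (tokens p) h′)))
                    (castL (S-∷ʳ Γ _) (rename q (∉-++ʳ (tokens p) h′))))
    where
    h′ : b ∉ tokens p ++ tokens q
    h′ = fresh-below π h
  rename π@(∨R₁ A B α p) h = ∨R₁ A B (f α) (rename p (fresh-below π h))
  rename π@(∨R₂ A B α p) h = ∨R₂ A B (f α) (rename p (fresh-below π h))
  rename π@(⇒L {Γ₁} {Δ₁} {Γ₂} {Δ₂} A B α p q) h =
    castL (sym (trans (S-∷ʳ (Γ₁ ++ Γ₂) _) (cong (_∷ʳ _) (S-++ Γ₁ Γ₂)))) (castR (sym (S-++ Δ₁ Δ₂))
      (⇒L A B (f α) (rename p (∉-++ˡ (tokens p) h′)) (castL (S-∷ʳ Γ₂ _) (rename q (∉-++ʳ (tokens p) h′)))))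
    where
    h′ : b ∉ tokens p ++ tokens q
    h′ = fresh-below π h
  rename π@(⇒R {Γ} A B α p) h = ⇒R A B (f α) (castL (S-∷ʳ Γ _) (rename p (fresh-below π h)))
  rename {M} π@(□L {Γ} {Δ} A α β ok p) h with f-extend α β
  ... | β′ , e , l =
    castL (sym (S-∷ʳ Γ _))
      (□L A (f α) β′ (box-ok M Γ Δ e l ok)
        (castL (trans (S-∷ʳ Γ _) (cong (λ s → S Γ ∷ʳ (A ^ s)) e)) (rename p (fresh-below π h))))
  rename {M} π@(◇R {Γ} {Δ} A α β ok p) h with f-extend α β
  ... | β′ , e , l =
    ◇R A (f α) β′ (box-ok M Γ Δ e l ok)
      (castR (cong (λ s → (A ^ s) ∷ S Δ) e) (rename p (fresh-below π h)))
  rename π@(□R {Γ} {Δ} A α x αx-fresh p) h with f-extend₁ α x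
  ... | x′ , e =
    □R A (f α) x′ (eigen-ok Γ Δ b∉Γ (∉-++ʳ (α ∷ʳ x) b∉αxΔ) (∉-++ˡ (α ∷ʳ x) b∉αxΔ) e αx-fresh)
      (castR (cong (λ s → (A ^ s) ∷ S Δ) e) (rename p b∉p))
    where
    b∉p : b ∉ tokens p
    b∉p = fresh-below π h
    b∉Γ : b ∉ tokensL Γ
    b∉Γ = proj₁ (fresh-conclusion p b∉p)
    b∉αxΔ : b ∉ (α ∷ʳ x) ++ tokensL Δ
    b∉αxΔ = proj₂ (fresh-conclusion p b∉p)
  rename π@(◇L {Γ} {Δ} A α x αx-fresh p) h with f-extend₁ α x
  ... | x′ , e =
    castL (sym (S-∷ʳ Γ _))
      (◇L A (f α) x′ (eigen-ok Γ Δ (proj₁ b∉Γ,αx) b∉Δ (proj₂ b∉Γ,αx) e αx-fresh)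
        (castL (trans (S-∷ʳ Γ _) (cong (λ s → S Γ ∷ʳ (A ^ s)) e)) (rename p b∉p)))
    where
    b∉p : b ∉ tokens p
    b∉p = fresh-below π h
    b∉Γ,αx : b ∉ tokensL Γ × b ∉ α ∷ʳ x
    b∉Γ,αx = fresh-∷ʳ Γ (A ^ (α ∷ʳ x)) (proj₁ (fresh-conclusion p b∉p))
    b∉Δ : b ∉ tokensL Δ
    b∉Δ = proj₂ (fresh-conclusion p b∉p)

mainTheorem8 : (M : Logic) {Γ Δ : List PFml} (Π : Proof M Γ Δ) (δ : Pos) (z b : Token) →
    b ∉ tokens Π → b ∉ (δ ∷ʳ z) →
    Proof M (Γ [ δ ∷ʳ z / δ ∷ʳ b ]) (Δ [ δ ∷ʳ z / δ ∷ʳ b ])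
mainTheorem8 M Π δ z b b∉Π _ = Renaming.rename δ z b Π b∉Π
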